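{- Let $d\ge2$, $m\ge0$ and $L\ge1$. Define $a_m^{(d)}(n)=\bigl(\sum_{p\ge0,\ p\,\&\,m=0}\delta_p(n)\bigr)\bmod d$, let $M=2^{K(m)}L$ and $N=d^M$. Then for all $j_1,j_2\in\{0,\dots,d-1\}$ and $k=0,\dots,s_mL-1$, \[ \sum_{\substack{0\le n<N\\ a_m^{(d)}(n)=j_1}}n^k=\sum_{\substack{0\le n<N\\ a_m^{(d)}(n)=j_2}}n^k. \]
   Context: For $n\ge0$, $n=\sum_{p\ge0}\delta_p(n)d^p$ with $\delta_p(n)\in\{0,\dots,d-1\}$ is its base-$d$ expansion. The condition $p\,\&\,m=0$ uses the bitwise AND of the binary expansions of $p$ and $m$. $K(m)=\max(1,\lceil\log_2(m+1)\rceil)$ and $s_m=|\{p\in[0,2^{K(m)}):p\,\&\,m=0\}|$. -}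

module Defs where

open import Data.Nat using (ℕ; zero; suc; _+_; _*_; _^_; _≡ᵇ_)
open import Data.Nat.DivMod using (_/_; _%_)
open import Data.Nat.Logarithm using (⌈log₂_⌉)
open import Data.Bool using (Bool; true; false; _∧_; _∨_; not; if_then_else_)

sumBelow : ℕ → (ℕ → ℕ) → ℕ
sumBelow zero    f = 0
sumBelow (suc n) f = sumBelow n f + f n

sumBelowIf : ℕ → (ℕ → Bool) → (ℕ → ℕ) → ℕ
sumBelowIf n P f = sumBelow n (λ i → if P i then f i else 0)

countBelow : ℕ → (ℕ → Bool) → ℕ
countBelow n P = sumBelowIf n P (λ _ → 1)

-- base-d digit δ_p(n) = ⌊n / d^p⌋ mod d, computed as δ_{p+1}(n) = δ_p(⌊n/d⌋) (only meaningful for d ≥ 2; 0 otherwise)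
digitB : (d : ℕ) → ℕ → ℕ → ℕ
digitB zero          p n = 0
digitB (suc zero)    p n = 0
digitB (suc (suc e)) zero    n = n % suc (suc e)
digitB (suc (suc e)) (suc p) n = digitB (suc (suc e)) p (n / suc (suc e))

-- bitwise AND is zero: p & m = 0, by recursion on binary expansions
-- (fuel k ≥ number of bits suffices; we use fuel p + m + 1)
andZeroFuel : ℕ → ℕ → ℕ → Bool
andZeroFuel zero    p m = true
andZeroFuel (suc k) p m =
  not ((p % 2 ≡ᵇ 1) ∧ (m % 2 ≡ᵇ 1)) ∧ andZeroFuel k (p / 2) (m / 2)

andZero : ℕ → ℕ → Bool
andZero p m = andZeroFuel (suc (p + m)) p m

K : ℕ → ℕ
K m with ⌈log₂ (suc m) ⌉
... | zero  = 1
... | suc k = suc k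

s : ℕ → ℕ
s m = countBelow (2 ^ K m) (λ p → andZero p m)

-- a_m^(d)(n) = (Σ_{p ≥ 0, p & m = 0} δ_p(n)) mod d.
-- Digits δ_p(n) vanish for p > n (as d^p > n), so the sum over p < n+1 is the full sum.
a : (d : ℕ) → ℕ → ℕ → ℕ
a zero          m n = 0
a (suc zero)    m n = 0
a (suc (suc e)) m n =
  sumBelowIf (suc n) (λ p → andZero p m) (λ p → digitB (suc (suc e)) p n) % suc (suc e)

-- Classify n < D^M by the residue mod D of the sum of its digits at the selected positions,
-- and split n = t + D n' at its lowest digit t.  If position 0 is not selected, the class
-- of n is that of n', and each f (t + D ·) has the same degree as f.  If it is selected,
-- the class is shifted by t and f (t + D n') = f (D n') + Δₜ (D n') with Δₜ of lower
-- degree: as t runs over all residues the first summand meets every class exactly once,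
-- while the second is balanced by induction, one selected position having been used up.
-- So a polynomial of degree below the number of selected positions has equal sums over
-- all classes.  For the theorem, p & m = 0 depends only on p mod 2^K(m), so s_m L of
-- the 2^K(m) L positions are selected, and n ↦ n^k has degree k < s_m L.
module Submission where

open import Defs
open import Data.Bool using (Bool; true; false; if_then_else_; _∧_; not; T)
open import Data.Bool.Properties using (∧-zeroʳ; if-swap-then)
open import Data.Empty using (⊥-elim)
open import Data.Nat
  using (ℕ; zero; suc; _+_; _*_; _^_; _≤_; _<_; _≡ᵇ_; z≤n; s≤s; s≤s⁻¹; _/_; _%_; NonZero; ⌈_/2⌉; ⌊_/2⌋; _≤′_; ≤′-refl; ≤′-step)
open import Data.Nat.DivMod
open import Data.Nat.Divisibility using (n∣m*n; m∣m*n)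
open import Data.Nat.Induction using (<-wellFounded)
open import Data.Nat.Logarithm using (⌈log₂_⌉)
open import Data.Nat.Logarithm.Core using (⌈log2⌉)
open import Data.Nat.Properties
open import Algebra.Properties.CommutativeSemigroup +-commutativeSemigroup using (interchange)
open import Data.Nat.Solver using (module +-*-Solver)
open import Data.Sum using (inj₁; inj₂)
open import Function using (_∘_)
open import Induction.WellFounded using (Acc; acc)
open import Relation.Binary.PropositionalEquality
open +-*-Solver using (solve; _:+_; _:*_; _:=_; con)

sumBelow-cong : ∀ n {f g : ℕ → ℕ} → (∀ i → i < n → f i ≡ g i) → sumBelow n f ≡ sumBelow n g
sumBelow-cong zero    f≗g = refl
sumBelow-cong (suc n) f≗g = cong₂ _+_ (sumBelow-cong n (λ i i<n → f≗g i (m<n⇒m<1+n i<n))) (f≗g n ≤-refl)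

sumBelow-zeros : ∀ n {f : ℕ → ℕ} → (∀ i → i < n → f i ≡ 0) → sumBelow n f ≡ 0
sumBelow-zeros zero    f≗0 = refl
sumBelow-zeros (suc n) f≗0 = cong₂ _+_ (sumBelow-zeros n (λ i i<n → f≗0 i (m<n⇒m<1+n i<n))) (f≗0 n ≤-refl)

sumBelow-const : ∀ n c → sumBelow n (λ _ → c) ≡ n * c
sumBelow-const zero    c = refl
sumBelow-const (suc n) c = trans (cong (_+ c) (sumBelow-const n c)) (+-comm (n * c) c)

sumBelow-distrib-+ : ∀ n (f g : ℕ → ℕ) → sumBelow n (λ i → f i + g i) ≡ sumBelow n f + sumBelow n g
sumBelow-distrib-+ zero    f g = refl
sumBelow-distrib-+ (suc n) f g =
  trans (cong (_+ (f n + g n)) (sumBelow-distrib-+ n f g)) (interchange (sumBelow n f) (sumBelow n g) (f n) (g n))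

sumBelow-comm : ∀ m n (h : ℕ → ℕ → ℕ) →
  sumBelow m (λ i → sumBelow n (λ j → h i j)) ≡ sumBelow n (λ j → sumBelow m (λ i → h i j))
sumBelow-comm zero    n h = sym (sumBelow-zeros n (λ _ _ → refl))
sumBelow-comm (suc m) n h =
  trans (cong (_+ sumBelow n (h m)) (sumBelow-comm m n h)) (sym (sumBelow-distrib-+ n _ (h m)))

sumBelow-+ : ∀ m n (g : ℕ → ℕ) → sumBelow (m + n) g ≡ sumBelow m g + sumBelow n (λ i → g (m + i))
sumBelow-+ m zero    g = trans (cong (λ k → sumBelow k g) (+-identityʳ m)) (sym (+-identityʳ _))
sumBelow-+ m (suc n) g = begin
    sumBelow (m + suc n) g
  ≡⟨ cong (λ k → sumBelow k g) (+-suc m n) ⟩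
    sumBelow (m + n) g + g (m + n)
  ≡⟨ cong (_+ g (m + n)) (sumBelow-+ m n g) ⟩
    sumBelow m g + sumBelow n (λ i → g (m + i)) + g (m + n)
  ≡⟨ +-assoc (sumBelow m g) _ _ ⟩
    sumBelow m g + sumBelow (suc n) (λ i → g (m + i))
  ∎ where open ≡-Reasoning

sumBelow-blocks : ∀ n m (g : ℕ → ℕ) →
  sumBelow (n * m) g ≡ sumBelow m (λ q → sumBelow n (λ r → g (r + n * q)))
sumBelow-blocks n zero    g = cong (λ k → sumBelow k g) (*-zeroʳ n)
sumBelow-blocks n (suc m) g = begin
    sumBelow (n * suc m) g
  ≡⟨ cong (λ k → sumBelow k g) (trans (*-suc n m) (+-comm n (n * m))) ⟩
    sumBelow (n * m + n) g
  ≡⟨ sumBelow-+ (n * m) n g ⟩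
    sumBelow (n * m) g + sumBelow n (λ r → g (n * m + r))
  ≡⟨ cong₂ _+_ (sumBelow-blocks n m g) (sumBelow-cong n (λ r _ → cong g (+-comm (n * m) r))) ⟩
    sumBelow (suc m) (λ q → sumBelow n (λ r → g (r + n * q)))
  ∎ where open ≡-Reasoning

sumBelow-suc : ∀ n (f : ℕ → ℕ) → sumBelow (suc n) f ≡ f 0 + sumBelow n (f ∘ suc)
sumBelow-suc zero    f = +-comm 0 (f 0)
sumBelow-suc (suc n) f = trans (cong (_+ f (suc n)) (sumBelow-suc n f)) (+-assoc (f 0) _ _)

sumBelow-rotate : ∀ n (f : ℕ → ℕ) → f n ≡ f 0 → sumBelow n (f ∘ suc) ≡ sumBelow n f
sumBelow-rotate n f fn≡f0 = +-cancelˡ-≡ (f 0) _ _ (begin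
    f 0 + sumBelow n (f ∘ suc)
  ≡⟨ sumBelow-suc n f ⟨
    sumBelow n f + f n
  ≡⟨ cong (sumBelow n f +_) fn≡f0 ⟩
    sumBelow n f + f 0
  ≡⟨ +-comm (sumBelow n f) (f 0) ⟩
    f 0 + sumBelow n f
  ∎) where open ≡-Reasoning

sumBelow-periodic-shift : ∀ n (f : ℕ → ℕ) → (∀ x → f (x + n) ≡ f x) →
  ∀ c → sumBelow n (λ t → f (t + c)) ≡ sumBelow n f
sumBelow-periodic-shift n f periodic zero    = sumBelow-cong n (λ t _ → cong f (+-identityʳ t))
sumBelow-periodic-shift n f periodic (suc c) = begin
    sumBelow n (λ t → f (t + suc c))
  ≡⟨ sumBelow-cong n (λ t _ → cong f (+-suc t c)) ⟩
    sumBelow n (λ t → f (suc t + c))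
  ≡⟨ sumBelow-rotate n (λ t → f (t + c)) (trans (cong f (+-comm n c)) (periodic c)) ⟩
    sumBelow n (λ t → f (t + c))
  ≡⟨ sumBelow-periodic-shift n f periodic c ⟩
    sumBelow n f
  ∎ where open ≡-Reasoning

sumBelow-tail-zero : ∀ {m n} (f : ℕ → ℕ) → (∀ p → m ≤ p → f p ≡ 0) → m ≤ n → sumBelow n f ≡ sumBelow m f
sumBelow-tail-zero {m} f tail≗0 m≤n = go (≤⇒≤′ m≤n)
  where
  go : ∀ {n} → m ≤′ n → sumBelow n f ≡ sumBelow m f
  go ≤′-refl            = refl
  go (≤′-step {n} m≤′n) = trans (cong₂ _+_ (go m≤′n) (tail≗0 n (≤′⇒≤ m≤′n))) (+-identityʳ _)

if-sumBelow : ∀ b n (g : ℕ → ℕ) → (if b then sumBelow n g else 0) ≡ sumBelow n (λ i → if b then g i else 0)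
if-sumBelow true  n g = refl
if-sumBelow false n g = sym (sumBelow-zeros n (λ _ _ → refl))

if-+ : ∀ b x y → (if b then x + y else 0) ≡ (if b then x else 0) + (if b then y else 0)
if-+ true  x y = refl
if-+ false x y = refl

if-zero : ∀ b {x} → x ≡ 0 → (if b then x else 0) ≡ 0
if-zero true  x≡0 = x≡0
if-zero false x≡0 = refl

sumBelowIf-cong : ∀ n P {f g : ℕ → ℕ} → (∀ i → i < n → f i ≡ g i) → sumBelowIf n P f ≡ sumBelowIf n P g
sumBelowIf-cong n P f≗g = sumBelow-cong n (λ i i<n → cong (λ v → if P i then v else 0) (f≗g i i<n))

sumBelowIf-distrib-+ : ∀ n P (f g : ℕ → ℕ) →
  sumBelowIf n P (λ i → f i + g i) ≡ sumBelowIf n P f + sumBelowIf n P g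
sumBelowIf-distrib-+ n P f g =
  trans (sumBelow-cong n (λ i _ → if-+ (P i) (f i) (g i))) (sumBelow-distrib-+ n _ _)

sumBelowIf-const : ∀ n P x → sumBelowIf n P (λ _ → x) ≡ x * countBelow n P
sumBelowIf-const zero    P x = sym (*-zeroʳ x)
sumBelowIf-const (suc n) P x with P n
... | true  = trans (cong (_+ x) (sumBelowIf-const n P x))
                    (sym (trans (*-distribˡ-+ x (countBelow n P) 1) (cong (x * countBelow n P +_) (*-identityʳ x))))
... | false = trans (+-identityʳ _) (trans (sumBelowIf-const n P x) (cong (x *_) (sym (+-identityʳ _))))

≡ᵇ-refl : ∀ n → (n ≡ᵇ n) ≡ true
≡ᵇ-refl zero    = refl
≡ᵇ-refl (suc n) = ≡ᵇ-refl n

≡ᵇ-sym : ∀ m n → (m ≡ᵇ n) ≡ (n ≡ᵇ m)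
≡ᵇ-sym zero    zero    = refl
≡ᵇ-sym zero    (suc n) = refl
≡ᵇ-sym (suc m) zero    = refl
≡ᵇ-sym (suc m) (suc n) = ≡ᵇ-sym m n

≢⇒≡ᵇ-false : ∀ m n → m ≢ n → (m ≡ᵇ n) ≡ false
≢⇒≡ᵇ-false m n m≢n with m ≡ᵇ n in eq
... | false = refl
... | true  = ⊥-elim (m≢n (≡ᵇ⇒≡ m n (subst T (sym eq) _)))

sumBelowIf-≡ᵇ-absent : ∀ n v (f : ℕ → ℕ) → n ≤ v → sumBelowIf n (_≡ᵇ v) f ≡ 0
sumBelowIf-≡ᵇ-absent n v f n≤v = sumBelow-zeros n (λ i i<n →
  cong (λ b → if b then f i else 0) (≢⇒≡ᵇ-false i v (<⇒≢ (<-≤-trans i<n n≤v))))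

sumBelowIf-≡ᵇ : ∀ n v (f : ℕ → ℕ) → v < n → sumBelowIf n (_≡ᵇ v) f ≡ f v
sumBelowIf-≡ᵇ (suc n) v f v<1+n with m≤n⇒m<n∨m≡n (s≤s⁻¹ v<1+n)
... | inj₁ v<n  = trans (cong₂ _+_ (sumBelowIf-≡ᵇ n v f v<n)
                                  (cong (λ b → if b then f n else 0) (≢⇒≡ᵇ-false n v (>⇒≢ v<n))))
                        (+-identityʳ (f v))
... | inj₂ refl rewrite ≡ᵇ-refl v = cong (_+ f v) (sumBelowIf-≡ᵇ-absent v v f ≤-refl)

-- Degree < r via finite differences, stated additively (f (x + h) ≡ f x + Δ x) to
-- avoid truncated subtraction: only functions with non-negative increments qualify.
data DegreeBelow : ℕ → (ℕ → ℕ) → Set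

record Increment (r : ℕ) (f : ℕ → ℕ) (h : ℕ) : Set where
  inductive
  constructor increment
  field
    Δ        : ℕ → ℕ
    Δ-degree : DegreeBelow r Δ
    shift    : ∀ x → f (x + h) ≡ f x + Δ x

data DegreeBelow where
  vanishing   : ∀ {r f} → (∀ x → f x ≡ 0) → DegreeBelow r f
  differences : ∀ {r f} → (∀ h → Increment r f h) → DegreeBelow (suc r) f

degreeBelow-cong : ∀ {r f g} → DegreeBelow r f → (∀ x → f x ≡ g x) → DegreeBelow r g
degreeBelow-cong (vanishing f≗0) f≗g = vanishing (λ x → trans (sym (f≗g x)) (f≗0 x))
degreeBelow-cong {f = f} {g} (differences Δf) f≗g = differences (λ h → go (Δf h))
  where
  go : ∀ {r h} → Increment r f h → Increment r g h
  go {h = h} (increment Δ Δ-deg f-shift) = increment Δ Δ-deg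
    (λ x → trans (sym (f≗g (x + h))) (trans (f-shift x) (cong (_+ Δ x) (f≗g x))))

degreeBelow-suc : ∀ {r f} → DegreeBelow r f → DegreeBelow (suc r) f
degreeBelow-suc (vanishing f≗0)  = vanishing f≗0
degreeBelow-suc (differences Δf) = differences (λ h → go (Δf h))
  where
  go : ∀ {r f h} → Increment r f h → Increment (suc r) f h
  go (increment Δ Δ-deg f-shift) = increment Δ (degreeBelow-suc Δ-deg) f-shift

degreeBelow-mono : ∀ {r s f} → r ≤ s → DegreeBelow r f → DegreeBelow s f
degreeBelow-mono {r} {f = f} r≤s f-deg = go (≤⇒≤′ r≤s)
  where
  go : ∀ {s} → r ≤′ s → DegreeBelow s f
  go ≤′-refl        = f-deg
  go (≤′-step r≤′s) = degreeBelow-suc (go r≤′s)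

degreeBelow-+ : ∀ {r f g} → DegreeBelow r f → DegreeBelow r g → DegreeBelow r (λ x → f x + g x)
degreeBelow-+ {g = g} (vanishing f≗0) g-deg = degreeBelow-cong g-deg (λ x → cong (_+ g x) (sym (f≗0 x)))
degreeBelow-+ {f = f} f-deg@(differences _) (vanishing g≗0) =
  degreeBelow-cong f-deg (λ x → trans (sym (+-identityʳ (f x))) (cong (f x +_) (sym (g≗0 x))))
degreeBelow-+ {f = f} {g} (differences Δf) (differences Δg) = differences (λ h → go (Δf h) (Δg h))
  where
  go : ∀ {r h} → Increment r f h → Increment r g h → Increment r (λ x → f x + g x) h
  go (increment Δ₁ Δ₁-deg f-shift) (increment Δ₂ Δ₂-deg g-shift) =
    increment (λ x → Δ₁ x + Δ₂ x) (degreeBelow-+ Δ₁-deg Δ₂-deg)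
      (λ x → trans (cong₂ _+_ (f-shift x) (g-shift x)) (interchange (f x) (Δ₁ x) (g x) (Δ₂ x)))

degreeBelow-scale : ∀ {r f} c → DegreeBelow r f → DegreeBelow r (λ x → c * f x)
degreeBelow-scale c (vanishing f≗0) = vanishing (λ x → trans (cong (c *_) (f≗0 x)) (*-zeroʳ c))
degreeBelow-scale {f = f} c (differences Δf) = differences (λ h → go (Δf h))
  where
  go : ∀ {r h} → Increment r f h → Increment r (λ x → c * f x) h
  go (increment Δ Δ-deg f-shift) = increment (λ x → c * Δ x) (degreeBelow-scale c Δ-deg)
    (λ x → trans (cong (c *_) (f-shift x)) (*-distribˡ-+ c (f x) (Δ x)))

degreeBelow-affine : ∀ {r f} t c → DegreeBelow r f → DegreeBelow r (λ x → f (t + c * x))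
degreeBelow-affine t c (vanishing f≗0) = vanishing (λ x → f≗0 (t + c * x))
degreeBelow-affine {f = f} t c (differences Δf) = differences (λ h → go (Δf (c * h)))
  where
  go : ∀ {r h} → Increment r f (c * h) → Increment r (λ x → f (t + c * x)) h
  go {h = h} (increment Δ Δ-deg f-shift) = increment (λ x → Δ (t + c * x)) (degreeBelow-affine t c Δ-deg)
    (λ x → trans (cong f (solve 4 (λ t c x h → t :+ c :* (x :+ h) := (t :+ c :* x) :+ c :* h) refl t c x h))
                 (f-shift (t + c * x)))

degreeBelow-x* : ∀ {r f} → DegreeBelow r f → DegreeBelow (suc r) (λ x → x * f x)
degreeBelow-x* (vanishing f≗0) = vanishing (λ x → trans (cong (x *_) (f≗0 x)) (*-zeroʳ x))
degreeBelow-x* {suc r} {f} f-deg@(differences Δf) = differences (λ h → go (Δf h))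
  where
  go : ∀ {h} → Increment r f h → Increment (suc r) (λ x → x * f x) h
  go {h} (increment Δ Δ-deg f-shift) =
    increment (λ x → (x * Δ x + h * f x) + h * Δ x)
      (degreeBelow-+ (degreeBelow-+ (degreeBelow-x* Δ-deg) (degreeBelow-scale h f-deg))
                     (degreeBelow-suc (degreeBelow-scale h Δ-deg)))
      (λ x → trans (cong ((x + h) *_) (f-shift x))
        (solve 4 (λ x h F G → (x :+ h) :* (F :+ G) := x :* F :+ ((x :* G :+ h :* F) :+ h :* G)) refl x h (f x) (Δ x)))

degreeBelow-^ : ∀ k → DegreeBelow (suc k) (_^ k)
degreeBelow-^ zero    = differences (λ h → increment (λ _ → 0) (vanishing (λ _ → refl)) (λ _ → refl))
degreeBelow-^ (suc k) = degreeBelow-x* (degreeBelow-^ k)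

[m%d+n]%d≡[m+n]%d : ∀ m n d .{{_ : NonZero d}} → (m % d + n) % d ≡ (m + n) % d
[m%d+n]%d≡[m+n]%d m n d = begin
    (m % d + n) % d
  ≡⟨ %-distribˡ-+ (m % d) n d ⟩
    (m % d % d + n % d) % d
  ≡⟨ cong (λ x → (x + n % d) % d) (m%n%n≡m%n m d) ⟩
    (m % d + n % d) % d
  ≡⟨ %-distribˡ-+ m n d ⟨
    (m + n) % d
  ∎ where open ≡-Reasoning

module ResidueClasses (D : ℕ) .{{_ : NonZero D}} where

  classSum : (ℕ → ℕ) → ℕ → ℕ → (ℕ → ℕ) → ℕ
  classSum c N j W = sumBelowIf N (λ n → c n % D ≡ᵇ j) W

  Balanced : (ℕ → ℕ) → ℕ → (ℕ → ℕ) → Set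
  Balanced c N W = ∀ j → j < D → classSum c N j W ≡ classSum c N 0 W

  balanced-vanishing : ∀ c N {W} → (∀ x → W x ≡ 0) → Balanced c N W
  balanced-vanishing c N W≗0 j _ = trans (vanish j) (sym (vanish 0))
    where
    vanish : ∀ j → classSum c N j _ ≡ 0
    vanish j = sumBelow-zeros N (λ n _ → if-zero (c n % D ≡ᵇ j) (W≗0 n))

  countBelow-residue : ∀ c j → j < D → countBelow D (λ t → (t + c) % D ≡ᵇ j) ≡ 1
  countBelow-residue c j j<D = begin
      sumBelow D (λ t → indicator (t + c))
    ≡⟨ sumBelow-periodic-shift D indicator
         (λ x → cong (λ v → if v ≡ᵇ j then 1 else 0) ([m+n]%n≡m%n x D)) c ⟩
      sumBelow D indicator
    ≡⟨ sumBelow-cong D (λ t t<D → cong (λ v → if v ≡ᵇ j then 1 else 0) (m<n⇒m%n≡m t<D)) ⟩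
      sumBelowIf D (_≡ᵇ j) (λ _ → 1)
    ≡⟨ sumBelowIf-≡ᵇ D j (λ _ → 1) j<D ⟩
      1
    ∎
    where
    open ≡-Reasoning
    indicator : ℕ → ℕ
    indicator x = if x % D ≡ᵇ j then 1 else 0

  classSum-partition : ∀ N c W (P : ℕ → Bool) →
    sumBelowIf N (λ n → P (c n % D)) W ≡ sumBelowIf D P (λ i → classSum c N i W)
  classSum-partition N c W P = sym (begin
      sumBelowIf D P (λ i → classSum c N i W)
    ≡⟨ sumBelow-cong D (λ i _ → if-sumBelow (P i) N _) ⟩
      sumBelow D (λ i → sumBelow N (λ n → if P i then (if c n % D ≡ᵇ i then W n else 0) else 0))
    ≡⟨ sumBelow-comm D N _ ⟩
      sumBelow N (λ n → sumBelow D (λ i → if P i then (if c n % D ≡ᵇ i then W n else 0) else 0))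
    ≡⟨ sumBelow-cong N (λ n _ → select-class n) ⟩
      sumBelowIf N (λ n → P (c n % D)) W
    ∎)
    where
    open ≡-Reasoning
    select-class : ∀ n → sumBelow D (λ i → if P i then (if c n % D ≡ᵇ i then W n else 0) else 0)
                           ≡ (if P (c n % D) then W n else 0)
    select-class n = trans
      (sumBelow-cong D (λ i _ → trans (if-swap-then (P i) (c n % D ≡ᵇ i))
                                      (cong (λ b → if b then (if P i then W n else 0) else 0) (≡ᵇ-sym (c n % D) i))))
      (sumBelowIf-≡ᵇ D (c n % D) (λ i → if P i then W n else 0) (m%n<n (c n) D))

  classSum-shift : ∀ c N {W} → Balanced c N W →
    ∀ t j → j < D → classSum (λ n → t + c n) N j W ≡ classSum c N 0 W
  classSum-shift c N {W} balanced t j j<D = begin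
      classSum (λ n → t + c n) N j W
    ≡⟨ sumBelow-cong N (λ n _ → cong (λ v → if v ≡ᵇ j then W n else 0)
         (trans (cong (_% D) (+-comm t (c n))) (sym ([m%d+n]%d≡[m+n]%d (c n) t D)))) ⟩
      sumBelowIf N (λ n → P (c n % D)) W
    ≡⟨ classSum-partition N c W P ⟩
      sumBelowIf D P (λ i → classSum c N i W)
    ≡⟨ sumBelowIf-cong D P balanced ⟩
      sumBelowIf D P (λ _ → classSum c N 0 W)
    ≡⟨ sumBelowIf-const D P _ ⟩
      classSum c N 0 W * countBelow D P
    ≡⟨ cong (classSum c N 0 W *_) (countBelow-residue t j j<D) ⟩
      classSum c N 0 W * 1
    ≡⟨ *-identityʳ _ ⟩
      classSum c N 0 W
    ∎
    where
    open ≡-Reasoning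
    P : ℕ → Bool
    P v = (v + t) % D ≡ᵇ j

  sumBelow-classSum-shift : ∀ (c : ℕ → ℕ) N W j → j < D →
    sumBelow D (λ t → classSum (λ n → t + c n) N j W) ≡ sumBelow N W
  sumBelow-classSum-shift c N W j j<D =
    trans (sumBelow-comm D N (λ t n → if (t + c n) % D ≡ᵇ j then W n else 0)) (sumBelow-cong N (λ n _ → begin
        sumBelowIf D (λ t → (t + c n) % D ≡ᵇ j) (λ _ → W n)
      ≡⟨ sumBelowIf-const D _ (W n) ⟩
        W n * countBelow D (λ t → (t + c n) % D ≡ᵇ j)
      ≡⟨ cong (W n *_) (countBelow-residue (c n) j j<D) ⟩
        W n * 1
      ≡⟨ *-identityʳ (W n) ⟩
        W n
      ∎))
    where open ≡-Reasoning

andZeroFuel-0 : ∀ k p → andZeroFuel k p 0 ≡ true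
andZeroFuel-0 zero    p = refl
andZeroFuel-0 (suc k) p rewrite ∧-zeroʳ (p % 2 ≡ᵇ 1) = andZeroFuel-0 k (p / 2)

m≤1+n⇒m/2≤n : ∀ m n → m ≤ suc n → m / 2 ≤ n
m≤1+n⇒m/2≤n zero    n _    = z≤n
m≤1+n⇒m/2≤n (suc m) n m≤n = ≤-trans (s≤s⁻¹ (m/n<m (suc m) 2 (s≤s (s≤s z≤n)))) (s≤s⁻¹ m≤n)

andZeroFuel-suc : ∀ k p m → m ≤ k → andZeroFuel k p m ≡ andZeroFuel (suc k) p m
andZeroFuel-suc zero    p zero z≤n = sym (andZeroFuel-0 1 p)
andZeroFuel-suc (suc k) p m m≤1+k =
  cong (not ((p % 2 ≡ᵇ 1) ∧ (m % 2 ≡ᵇ 1)) ∧_) (andZeroFuel-suc k (p / 2) (m / 2) (m≤1+n⇒m/2≤n m k m≤1+k))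

andZeroFuel-enough : ∀ k p m → m ≤ k → andZeroFuel k p m ≡ andZeroFuel m p m
andZeroFuel-enough k p m m≤k = go (≤⇒≤′ m≤k)
  where
  go : ∀ {k} → m ≤′ k → andZeroFuel k p m ≡ andZeroFuel m p m
  go ≤′-refl            = refl
  go (≤′-step {k} m≤′k) = trans (sym (andZeroFuel-suc k p m (≤′⇒≤ m≤′k))) (go m≤′k)

andZero≡andZeroFuel : ∀ p m → andZero p m ≡ andZeroFuel m p m
andZero≡andZeroFuel p m = andZeroFuel-enough (suc (p + m)) p m (≤-trans (m≤n+m m p) (n≤1+n _))

andZeroFuel-periodic : ∀ k b p q m → m < 2 ^ b → andZeroFuel k (p + 2 ^ b * q) m ≡ andZeroFuel k p m
andZeroFuel-periodic zero    b       p q m       m<2^b = refl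
andZeroFuel-periodic (suc k) zero    p q zero    _     =
  trans (andZeroFuel-0 (suc k) (p + 1 * q)) (sym (andZeroFuel-0 (suc k) p))
andZeroFuel-periodic (suc k) zero    p q (suc m) (s≤s ())
andZeroFuel-periodic (suc k) (suc b) p q m       m<2^b = begin
    andZeroFuel (suc k) (p + 2 ^ suc b * q) m
  ≡⟨ cong (λ x → andZeroFuel (suc k) x m) (cong (p +_) 2^[1+b]q≡2^bq*2) ⟩
    andZeroFuel (suc k) (p + 2 ^ b * q * 2) m
  ≡⟨ cong₂ (λ u v → not ((u ≡ᵇ 1) ∧ (m % 2 ≡ᵇ 1)) ∧ v) ([m+kn]%n≡m%n p (2 ^ b * q) 2)
           (cong (λ x → andZeroFuel k x (m / 2)) halve) ⟩
    not ((p % 2 ≡ᵇ 1) ∧ (m % 2 ≡ᵇ 1)) ∧ andZeroFuel k (p / 2 + 2 ^ b * q) (m / 2)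
  ≡⟨ cong (not ((p % 2 ≡ᵇ 1) ∧ (m % 2 ≡ᵇ 1)) ∧_)
       (andZeroFuel-periodic k b (p / 2) q (m / 2) m/2<2^b) ⟩
    andZeroFuel (suc k) p m
  ∎
  where
  open ≡-Reasoning
  2^[1+b]q≡2^bq*2 : 2 ^ suc b * q ≡ 2 ^ b * q * 2
  2^[1+b]q≡2^bq*2 = solve 2 (λ x q → (con 2 :* x) :* q := x :* q :* con 2) refl (2 ^ b) q
  m/2<2^b : m / 2 < 2 ^ b
  m/2<2^b = m<n*o⇒m/o<n (<-≤-trans m<2^b (≤-reflexive (*-comm 2 (2 ^ b))))
  halve : (p + 2 ^ b * q * 2) / 2 ≡ p / 2 + 2 ^ b * q
  halve = trans (+-distrib-/-∣ʳ p (n∣m*n (2 ^ b * q))) (cong (p / 2 +_) (m*n/n≡m (2 ^ b * q) 2))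

andZero-periodic : ∀ b p q m → m < 2 ^ b → andZero (p + 2 ^ b * q) m ≡ andZero p m
andZero-periodic b p q m m<2^b = begin
    andZero (p + 2 ^ b * q) m
  ≡⟨ andZero≡andZeroFuel (p + 2 ^ b * q) m ⟩
    andZeroFuel m (p + 2 ^ b * q) m
  ≡⟨ andZeroFuel-periodic m b p q m m<2^b ⟩
    andZeroFuel m p m
  ≡⟨ andZero≡andZeroFuel p m ⟨
    andZero p m
  ∎ where open ≡-Reasoning

n≤2^⌈log2⌉n : ∀ n (rec : Acc _<_ n) → n ≤ 2 ^ ⌈log2⌉ n rec
n≤2^⌈log2⌉n zero          _         = z≤n
n≤2^⌈log2⌉n (suc zero)    _         = s≤s z≤n
n≤2^⌈log2⌉n (suc (suc n)) (acc rec) =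
  ≤-trans 2+n≤2*[1+⌈n/2⌉] (*-monoʳ-≤ 2 (n≤2^⌈log2⌉n (suc ⌈ n /2⌉) (rec (⌈n/2⌉<n n))))
  where
  2+n≤2*[1+⌈n/2⌉] : suc (suc n) ≤ 2 * suc ⌈ n /2⌉
  2+n≤2*[1+⌈n/2⌉] = begin
      suc (suc n)
    ≡⟨ cong (suc ∘ suc) (⌊n/2⌋+⌈n/2⌉≡n n) ⟨
      suc (suc (⌊ n /2⌋ + ⌈ n /2⌉))
    ≤⟨ s≤s (s≤s (+-monoˡ-≤ ⌈ n /2⌉ (⌊n/2⌋≤⌈n/2⌉ n))) ⟩
      suc (suc (⌈ n /2⌉ + ⌈ n /2⌉))
    ≡⟨ solve 1 (λ c → con 2 :+ (c :+ c) := con 2 :* (con 1 :+ c)) refl ⌈ n /2⌉ ⟩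
      2 * suc ⌈ n /2⌉
    ∎ where open ≤-Reasoning

m<2^Km : ∀ m → m < 2 ^ K m
m<2^Km m with ⌈log₂ (suc m) ⌉ | n≤2^⌈log2⌉n (suc m) (<-wellFounded (suc m))
... | zero  | 1+m≤1   = ≤-trans 1+m≤1 (s≤s z≤n)
... | suc k | 1+m≤2^k = 1+m≤2^k

countBelow-andZero : ∀ m L → countBelow (2 ^ K m * L) (λ p → andZero p m) ≡ s m * L
countBelow-andZero m L = begin
    countBelow (2 ^ K m * L) (λ p → andZero p m)
  ≡⟨ sumBelow-blocks (2 ^ K m) L _ ⟩
    sumBelow L (λ q → sumBelow (2 ^ K m) (λ r → if andZero (r + 2 ^ K m * q) m then 1 else 0))
  ≡⟨ sumBelow-cong L (λ q _ → sumBelow-cong (2 ^ K m) (λ r _ →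
       cong (λ b → if b then 1 else 0) (andZero-periodic (K m) r q m (m<2^Km m)))) ⟩
    sumBelow L (λ _ → s m)
  ≡⟨ sumBelow-const L (s m) ⟩
    L * s m
  ≡⟨ *-comm L (s m) ⟩
    s m * L
  ∎ where open ≡-Reasoning

module DigitSums (e : ℕ) where

  D : ℕ
  D = suc (suc e)

  open ResidueClasses D public

  digitSum : (ℕ → Bool) → ℕ → ℕ → ℕ
  digitSum A M n = sumBelowIf M A (λ p → digitB D p n)

  digitB-0 : ∀ t n → t < D → digitB D 0 (t + D * n) ≡ t
  digitB-0 t n t<D =
    trans (cong (λ x → (t + x) % D) (*-comm D n)) (trans ([m+kn]%n≡m%n t n D) (m<n⇒m%n≡m t<D))

  [t+Dn]/D≡n : ∀ t n → t < D → (t + D * n) / D ≡ n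
  [t+Dn]/D≡n t n t<D = trans (+-distrib-/-∣ʳ t (m∣m*n n))
    (cong₂ _+_ (m<n⇒m/n≡0 t<D) (trans (cong (_/ D) (*-comm D n)) (m*n/n≡m n D)))

  digitSum-suc : ∀ A M t n → t < D →
    digitSum A (suc M) (t + D * n) ≡ (if A 0 then t else 0) + digitSum (A ∘ suc) M n
  digitSum-suc A M t n t<D = trans (sumBelow-suc M _)
    (cong₂ _+_ (cong (λ x → if A 0 then x else 0) (digitB-0 t n t<D))
               (sumBelowIf-cong M (A ∘ suc) (λ p _ → cong (digitB D p) ([t+Dn]/D≡n t n t<D))))

  classSum-digitSum-suc : ∀ {A b} M j (f : ℕ → ℕ) → A 0 ≡ b →
    classSum (digitSum A (suc M)) (D ^ suc M) j f
      ≡ sumBelow D (λ t → classSum (λ n → (if b then t else 0) + digitSum (A ∘ suc) M n) (D ^ M) j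
                                    (λ n → f (t + D * n)))
  classSum-digitSum-suc {A} {b} M j f A0≡b = begin
      sumBelow (D * D ^ M) g
    ≡⟨ sumBelow-blocks D (D ^ M) g ⟩
      sumBelow (D ^ M) (λ n → sumBelow D (λ t → g (t + D * n)))
    ≡⟨ sumBelow-comm (D ^ M) D (λ n t → g (t + D * n)) ⟩
      sumBelow D (λ t → sumBelow (D ^ M) (λ n → g (t + D * n)))
    ≡⟨ sumBelow-cong D (λ t t<D → sumBelow-cong (D ^ M) (λ n _ →
         cong (λ v → if v % D ≡ᵇ j then f (t + D * n) else 0) (digitSum-split t n t<D))) ⟩
      sumBelow D (λ t → classSum (λ n → (if b then t else 0) + digitSum (A ∘ suc) M n) (D ^ M) j
                                 (λ n → f (t + D * n)))
    ∎
    where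
    open ≡-Reasoning
    g : ℕ → ℕ
    g x = if digitSum A (suc M) x % D ≡ᵇ j then f x else 0
    digitSum-split : ∀ t n → t < D → digitSum A (suc M) (t + D * n) ≡ (if b then t else 0) + digitSum (A ∘ suc) M n
    digitSum-split t n t<D =
      trans (digitSum-suc A M t n t<D) (cong (λ b → (if b then t else 0) + digitSum (A ∘ suc) M n) A0≡b)

  countBelow-suc : ∀ {A b} M → A 0 ≡ b → countBelow (suc M) A ≡ (if b then 1 else 0) + countBelow M (A ∘ suc)
  countBelow-suc {A} M A0≡b =
    trans (sumBelow-suc M _) (cong (λ b → (if b then 1 else 0) + countBelow M (A ∘ suc)) A0≡b)

  balanced-inactive : ∀ {A M f} → A 0 ≡ false →
    (∀ t → Balanced (digitSum (A ∘ suc) M) (D ^ M) (λ n → f (t + D * n))) →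
    Balanced (digitSum A (suc M)) (D ^ suc M) f
  balanced-inactive {A} {M} {f} A0≡false balanced j j<D = begin
      classSum (digitSum A (suc M)) (D ^ suc M) j f
    ≡⟨ classSum-digitSum-suc M j f A0≡false ⟩
      sumBelow D (λ t → classSum (digitSum (A ∘ suc) M) (D ^ M) j (λ n → f (t + D * n)))
    ≡⟨ sumBelow-cong D (λ t _ → balanced t j j<D) ⟩
      sumBelow D (λ t → classSum (digitSum (A ∘ suc) M) (D ^ M) 0 (λ n → f (t + D * n)))
    ≡⟨ classSum-digitSum-suc M 0 f A0≡false ⟨
      classSum (digitSum A (suc M)) (D ^ suc M) 0 f
    ∎ where open ≡-Reasoning

  balanced-active : ∀ {A M f} → A 0 ≡ true → (Δ : ℕ → ℕ → ℕ) → (∀ t x → f (x + t) ≡ f x + Δ t x) →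
    (∀ t → Balanced (digitSum (A ∘ suc) M) (D ^ M) (λ n → Δ t (D * n))) →
    Balanced (digitSum A (suc M)) (D ^ suc M) f
  balanced-active {A} {M} {f} A0≡true Δ f-shift balanced j j<D = trans (split j j<D) (sym (split 0 (s≤s z≤n)))
    where
    c : ℕ → ℕ
    c = digitSum (A ∘ suc) M
    split : ∀ j → j < D →
      classSum (digitSum A (suc M)) (D ^ suc M) j f
        ≡ sumBelow (D ^ M) (λ n → f (D * n)) + sumBelow D (λ t → classSum c (D ^ M) 0 (λ n → Δ t (D * n)))
    split j j<D = begin
        classSum (digitSum A (suc M)) (D ^ suc M) j f
      ≡⟨ classSum-digitSum-suc M j f A0≡true ⟩
        sumBelow D (λ t → classSum (λ n → t + c n) (D ^ M) j (λ n → f (t + D * n)))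
      ≡⟨ sumBelow-cong D (λ t _ → trans
           (sumBelowIf-cong (D ^ M) (P t) (λ n _ → trans (cong f (+-comm t (D * n))) (f-shift t (D * n))))
           (sumBelowIf-distrib-+ (D ^ M) (P t) (λ n → f (D * n)) (λ n → Δ t (D * n)))) ⟩
        sumBelow D (λ t → classSum (λ n → t + c n) (D ^ M) j (λ n → f (D * n))
                          + classSum (λ n → t + c n) (D ^ M) j (λ n → Δ t (D * n)))
      ≡⟨ sumBelow-distrib-+ D _ _ ⟩
        sumBelow D (λ t → classSum (λ n → t + c n) (D ^ M) j (λ n → f (D * n)))
          + sumBelow D (λ t → classSum (λ n → t + c n) (D ^ M) j (λ n → Δ t (D * n)))
      ≡⟨ cong₂ _+_ (sumBelow-classSum-shift c (D ^ M) _ j j<D)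
                   (sumBelow-cong D (λ t _ → classSum-shift c (D ^ M) (balanced t) t j j<D)) ⟩
        sumBelow (D ^ M) (λ n → f (D * n)) + sumBelow D (λ t → classSum c (D ^ M) 0 (λ n → Δ t (D * n)))
      ∎
      where
      open ≡-Reasoning
      P : ℕ → ℕ → Bool
      P t n = (t + c n) % D ≡ᵇ j

  digitSum-balanced : ∀ M {A r f} → DegreeBelow r f → r ≤ countBelow M A → Balanced (digitSum A M) (D ^ M) f
  digitSum-balanced M {A} (vanishing f≗0) _ = balanced-vanishing (digitSum A M) (D ^ M) f≗0
  digitSum-balanced zero    (differences _) ()
  digitSum-balanced (suc M) {A} f-deg@(differences Δf) 1+r≤count with A 0 in A0
  ... | false = balanced-inactive {A} {M} A0 (λ t → digitSum-balanced M (degreeBelow-affine t D f-deg)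
                  (≤-trans 1+r≤count (≤-reflexive (countBelow-suc M A0))))
  ... | true  = balanced-active {A} {M} A0 (λ t → Increment.Δ (Δf t)) (λ t → Increment.shift (Δf t))
                  (λ t → digitSum-balanced M (degreeBelow-affine 0 D (Increment.Δ-degree (Δf t)))
                    (s≤s⁻¹ (≤-trans 1+r≤count (≤-reflexive (countBelow-suc M A0)))))

  digitB-vanishes : ∀ p n → n < D ^ p → digitB D p n ≡ 0
  digitB-vanishes zero    zero    _         = refl
  digitB-vanishes zero    (suc n) (s≤s ())
  digitB-vanishes (suc p) n       n<D^p =
    digitB-vanishes p (n / D) (m<n*o⇒m/o<n (<-≤-trans n<D^p (≤-reflexive (*-comm D (D ^ p)))))

  n<D^n : ∀ n → n < D ^ n
  n<D^n zero    = s≤s z≤n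
  n<D^n (suc n) = ≤-trans (+-mono-≤ (m^n>0 D n) (n<D^n n)) (+-monoʳ-≤ (D ^ n) (m≤m+n (D ^ n) (e * D ^ n)))

  digitSum-stable : ∀ A {M N} n → n < D ^ M → M ≤ N → digitSum A N n ≡ digitSum A M n
  digitSum-stable A {M} n n<D^M = sumBelow-tail-zero _ (λ p M≤p →
    if-zero (A p) (digitB-vanishes p n (<-≤-trans n<D^M (^-monoʳ-≤ D M≤p))))

  a≡digitSum%D : ∀ m M n → n < D ^ M → a D m n ≡ digitSum (λ p → andZero p m) M n % D
  a≡digitSum%D m M n n<D^M with ≤-total M (suc n)
  ... | inj₁ M≤1+n = cong (_% D) (digitSum-stable _ n n<D^M M≤1+n)
  ... | inj₂ 1+n≤M =
    cong (_% D) (sym (digitSum-stable _ n (<-≤-trans (n<D^n n) (^-monoʳ-≤ D (n≤1+n n))) 1+n≤M))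

theorem58 : (d m L : ℕ) → 2 ≤ d → 1 ≤ L →
    (j₁ j₂ k : ℕ) → j₁ < d → j₂ < d → k < s m * L →
    sumBelowIf (d ^ (2 ^ K m * L)) (λ n → a d m n ≡ᵇ j₁) (λ n → n ^ k)
      ≡ sumBelowIf (d ^ (2 ^ K m * L)) (λ n → a d m n ≡ᵇ j₂) (λ n → n ^ k)
theorem58 (suc (suc e)) m L (s≤s (s≤s z≤n)) _ j₁ j₂ k j₁<d j₂<d k<sL =
  begin
    sumBelowIf (D ^ M) (λ n → a D m n ≡ᵇ j₁) (_^ k)   ≡⟨ as-classSum j₁ ⟩
    classSum (digitSum A M) (D ^ M) j₁ (_^ k)           ≡⟨ balanced j₁ j₁<d ⟩
    classSum (digitSum A M) (D ^ M) 0 (_^ k)            ≡⟨ balanced j₂ j₂<d ⟨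
    classSum (digitSum A M) (D ^ M) j₂ (_^ k)           ≡⟨ as-classSum j₂ ⟨
    sumBelowIf (D ^ M) (λ n → a D m n ≡ᵇ j₂) (_^ k)
  ∎
  where
  open ≡-Reasoning
  open DigitSums e
  M : ℕ
  M = 2 ^ K m * L
  A : ℕ → Bool
  A p = andZero p m
  balanced : Balanced (digitSum A M) (D ^ M) (_^ k)
  balanced = digitSum-balanced M (degreeBelow-mono k<sL (degreeBelow-^ k)) (≤-reflexive (sym (countBelow-andZero m L)))
  as-classSum : ∀ j → sumBelowIf (D ^ M) (λ n → a D m n ≡ᵇ j) (_^ k) ≡ classSum (digitSum A M) (D ^ M) j (_^ k)
  as-classSum j = sumBelow-cong (D ^ M) (λ n n<D^M →
    cong (λ v → if v ≡ᵇ j then n ^ k else 0) (a≡digitSum%D m M n n<D^M))
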